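{- Let $n\geq1$ and let $f:(X,*)\rightarrow(Y,\star)$ be a $\bm{\mu}_n$-equivariant pointed map of finite free pointed $\bm{\mu}_{n}$-sets such that $f^{ -1}(\star)=\{*\}$ and the cardinality of $f^{ -1}(y)$ is congruent to $1$ modulo $n$ for every $y\in Y\smallsetminus\{\star\}$. Then there is a canonical isomorphism of pointed $\bm{\mu}_n$-sets $\det(Y)\xrightarrow{\sim}\det(X)$.
   Context: $\bm{\mu}_n$ is the cyclic group of $n$-th roots of unity. A finite free pointed $\bm{\mu}_n$-set is a finite pointed set $(X,*)$ with a $\bm{\mu}_n$-action fixing $*$ and free on $X\smallsetminus\{*\}$. A $\bm{\mu}_n$-line is a set with a free transitive $\bm{\mu}_n$-action; the tensor product $L\otimes M$ of two lines is $L\times M$ modulo $(\mu l,m)\sim(l,\mu m)$, a line via $\mu\cdot(l,m)=(\mu l,m)$; this is associative and commutative up to canonical isomorphism. If the $\bm{\mu}_n$-orbits of $X\smallsetminus\{*\}$ are $L_1,\dots,L_t$, then $\det(X)=\{*\}\sqcup(L_1\otimes\cdots\otimes L_t)$, with the convention that the empty tensor product is $\bm{\mu}_n$. -}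

module Defs where

open import Data.Nat using (ℕ; zero; suc; _+_; _%_; NonZero)
open import Data.Nat.Divisibility using (_∣_)
open import Data.Fin using (Fin)
import Data.Fin.Properties as FinP
open import Data.List using (List; map; filter; length; allFin)
open import Data.Nat.ListAction using (sum)
open import Data.Maybe using (Maybe; just; nothing)
open import Data.Product using (Σ; ∃; _×_; _,_)
open import Data.Unit using (⊤)
open import Data.Empty using (⊥)
open import Function.Bundles using (_↔_; Inverse)
open import Relation.Nullary using (yes; no; ¬?)
open import Relation.Nullary.Decidable using (_×-dec_)
open import Relation.Binary.Definitions using (DecidableEquality)
open import Relation.Binary.PropositionalEquality
  using (_≡_; _≢_; refl; sym; trans; cong)

iter : {A : Set} → ℕ → (A → A) → A → A
iter zero    g x = x
iter (suc k) g x = g (iter k g x)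

-- A finite free pointed μₙ-set.  μₙ is cyclic of order n generated by
-- ζ = e^{2πi/n}; a μₙ-action is given by the action  ζ·_  of the
-- generator, subject to (ζ·_)ⁿ = id.
record FPSet (n : ℕ) : Set₁ where
  field
    Carrier : Set
    size    : ℕ
    enum    : Fin size ↔ Carrier
    pt      : Carrier
    ζ·      : Carrier → Carrier
    ζⁿ      : ∀ x → iter n ζ· x ≡ x
    fixPt   : ζ· pt ≡ pt
    free    : ∀ x → x ≢ pt → ∀ k → iter k ζ· x ≡ x → n ∣ k

  _≟_ : DecidableEquality Carrier
  x ≟ y with Inverse.from enum x FinP.≟ Inverse.from enum y
  ... | yes p = yes (trans (sym (Inverse.strictlyInverseˡ enum x))
                      (trans (cong (Inverse.to enum) p)
                             (Inverse.strictlyInverseˡ enum y)))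
  ... | no ¬p = no (λ x≡y → ¬p (cong (Inverse.from enum) x≡y))

  elements : List Carrier
  elements = map (Inverse.to enum) (allFin size)

open FPSet

record Hom {n : ℕ} (X Y : FPSet n) : Set where
  field
    fun     : Carrier X → Carrier Y
    pointed : fun (pt X) ≡ pt Y
    equivar : ∀ x → fun (ζ· X x) ≡ ζ· Y (fun x)

open Hom

fiberSize : {n : ℕ} {X Y : FPSet n} → Hom X Y → Carrier Y → ℕ
fiberSize {X = X} {Y} f y =
  length (filter (λ x → _≟_ Y (fun f x) y) (elements X))

-- The determinant det(X) = {*} ⊔ (L₁ ⊗ ⋯ ⊗ Lₜ)  (Lᵢ the orbits of X∖{*}).
--
-- A "selection" picks one element in every orbit of X∖{*}
-- (an element of L₁ × ⋯ × Lₜ), encoded as an orbit-constant map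
-- r with r x in the orbit of x.
record Sel {n : ℕ} (X : FPSet n) : Set where
  field
    sel      : Carrier X → Carrier X
    inOrbit  : ∀ x → x ≢ pt X → ∃ λ k → sel x ≡ iter k (ζ· X) x
    orbConst : ∀ x → x ≢ pt X → sel (ζ· X x) ≡ sel x

open Sel

reps : {n : ℕ} {X : FPSet n} → Sel X → List (Carrier X)
reps {X = X} r =
  filter (λ x → ¬? (_≟_ X x (pt X)) ×-dec _≟_ X (sel r x) x) (elements X)

-- Underlying type of det(X): nothing = base point, just (k , r) stands
-- for ζᵏ ⊗ (⊗ᵢ rᵢ) ∈ μₙ ⊗ L₁ ⊗ ⋯ ⊗ Lₜ ≅ L₁ ⊗ ⋯ ⊗ Lₜ
-- (this also gives μₙ when t = 0, matching the convention).
Det : {n : ℕ} → FPSet n → Set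
Det X = Maybe (ℕ × Sel X)

-- The tensor-product identification (quotient presented as a relation):
-- (k , r) ~ (k' , r')  iff  r'ᵢ = ζ^{dᵢ} rᵢ on every orbit and
-- ζ^{k + Σ dᵢ} = ζ^{k'}.
_≈Det_ : {n : ℕ} .{{_ : NonZero n}} {X : FPSet n} → Det X → Det X → Set
_≈Det_ nothing nothing = ⊤
_≈Det_ nothing (just _) = ⊥
_≈Det_ (just _) nothing = ⊥
_≈Det_ {n} {X = X} (just (k , r)) (just (k' , r')) =
  Σ (Carrier X → ℕ) λ d →
    (∀ x → x ≢ pt X → sel r' x ≡ iter (d x) (ζ· X) (sel r x))
    × ((k + sum (map d (reps r))) % n ≡ k' % n)

ζ·Det : {n : ℕ} {X : FPSet n} → Det X → Det X
ζ·Det nothing = nothing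
ζ·Det (just (k , r)) = just (suc k , r)

record DetIso {n : ℕ} .{{_ : NonZero n}} (Y X : FPSet n) : Set where
  field
    to       : Det Y → Det X
    from     : Det X → Det Y
    to-cong  : ∀ {a b} → a ≈Det b → to a ≈Det to b
    from-cong : ∀ {a b} → a ≈Det b → from a ≈Det from b
    from-to  : ∀ a → from (to a) ≈Det a
    to-from  : ∀ b → to (from b) ≈Det b
    to-pt    : to nothing ≈Det nothing
    to-equiv : ∀ a → to (ζ·Det a) ≈Det ζ·Det (to a)

-- Canonicity: for a selection s of Y and a selection r of X lying over it
-- (f (r x) = s (f x); r picks, in each orbit of X over the orbit of y = s(..),
-- the unique preimage of the chosen point), the isomorphism sends
-- ⊗ sⱼ  to  ⊗ rᵢ.
Canonical : {n : ℕ} .{{_ : NonZero n}} {X Y : FPSet n} →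
            Hom X Y → DetIso Y X → Set
Canonical {X = X} f φ =
  ∀ (s : Sel _) (r : Sel X) →
    (∀ x → x ≢ pt X → fun f (sel r x) ≡ sel s (fun f x)) →
    DetIso.to φ (just (0 , s)) ≈Det just (0 , r)

{-# OPTIONS --safe #-}

-- Two selections r, r′ differ on each orbit
-- by an exponent δ r r′, and the total exponent Δ r r′ (the sum of δ r r′ over one representative
-- per orbit) satisfies (k , r) ≈ (k′ , r′) iff k + Δ r r′ ≡ k′ (mod n); Δ is a cocycle because
-- such sums do not depend on the choice of representatives.
--
-- Since f reflects the base point and μₙ acts freely on Y ∖ {⋆}, every orbit of X ∖ {*} contains
-- exactly one point over the point that a selection s of Y picks in the image orbit; this defines
-- the lifted selection, and det Y → det X sends (k , s) to (k , lift s).  The orbits of X over an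
-- orbit of Y correspond to the fibre over its chosen point, of size ≡ 1 (mod n), so lifting
-- preserves Δ mod n.  Hence the map respects ≈, and (k , r) ↦ (k + Δ r (lift s₀) , s₀), for a
-- fixed selection s₀ of Y, is its inverse.

module Submission where

open import Defs
open import Data.Nat using (ℕ; zero; suc; _+_; _*_; _∸_; _%_; _/_; _≤_; NonZero)
open import Data.Nat.Properties hiding (_≟_)
open import Data.Nat.DivMod using (m≡m%n+[m/n]*n; m%n<n; %-distribˡ-+; %-distribˡ-*; %-remove-+ˡ)
open import Data.Nat.ListAction using (sum)
open import Algebra.Properties.CommutativeSemigroup +-commutativeSemigroup using (interchange; x∙yz≈y∙xz)
open import Data.Fin using (Fin; toℕ; fromℕ<)
open import Data.Fin.Properties using (any?; toℕ-fromℕ<)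
open import Data.List using (List; []; _∷_; map; filter; length; head)
open import Data.List.Properties using (filter-accept; filter-reject; filter-none; filter-≐)
open import Data.List.Membership.Propositional using (_∈_)
open import Data.List.Membership.Propositional.Properties using (∈-map⁺; ∈-allFin; ∈-filter⁺; ∈-filter⁻)
open import Data.List.Relation.Unary.Any using (here; there)
open import Data.List.Relation.Unary.All using (All; []; _∷_)
import Data.List.Relation.Unary.All as All
open import Data.List.Relation.Unary.All.Properties using (all-filter)
open import Data.List.Relation.Unary.Unique.Propositional using (Unique; []; _∷_)
open import Data.List.Relation.Unary.Unique.Propositional.Properties using (map⁺; allFin⁺; filter⁺)
open import Data.Maybe using (just; nothing; fromMaybe)
open import Data.Product using (Σ; ∃; _×_; _,_; proj₁; proj₂)
open import Data.Sum using (inj₁; inj₂)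
open import Data.Unit using (tt)
open import Function using (_∘_)
open import Function.Bundles using (Inverse)
open import Relation.Nullary using (Dec; yes; no; ¬_; ¬?; contradiction)
open import Relation.Nullary.Decidable using (_×-dec_; map′)
open import Relation.Unary using (Decidable; _⊆_)
open import Relation.Binary.Definitions using (DecidableEquality)
open import Relation.Binary.PropositionalEquality
open ≡-Reasoning

iter-+ : {A : Set} (a b : ℕ) (g : A → A) (x : A) → iter (a + b) g x ≡ iter a g (iter b g x)
iter-+ zero    b g x = refl
iter-+ (suc a) b g x = cong g (iter-+ a b g x)

module _ {A : Set} where

  sum-map-cong : {g h : A → ℕ} (xs : List A) → (∀ {x} → x ∈ xs → g x ≡ h x) →
                 sum (map g xs) ≡ sum (map h xs)
  sum-map-cong []       g≡h = refl
  sum-map-cong (x ∷ xs) g≡h = cong₂ _+_ (g≡h (here refl)) (sum-map-cong xs (g≡h ∘ there))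

  sum-map-zero : {g : A → ℕ} (xs : List A) → (∀ {x} → x ∈ xs → g x ≡ 0) → sum (map g xs) ≡ 0
  sum-map-zero []       _   = refl
  sum-map-zero (x ∷ xs) g≡0 = cong₂ _+_ (g≡0 (here refl)) (sum-map-zero xs (g≡0 ∘ there))

  sum-map-+ : (g h : A → ℕ) (xs : List A) →
              sum (map (λ x → g x + h x) xs) ≡ sum (map g xs) + sum (map h xs)
  sum-map-+ g h []       = refl
  sum-map-+ g h (x ∷ xs) = trans (cong (g x + h x +_) (sum-map-+ g h xs))
                                 (interchange (g x) (h x) _ _)

  sum-map-bump : {f f′ : A → ℕ} (a : ℕ) {c : A} {xs : List A} → Unique xs → c ∈ xs →
                 (∀ y → y ≢ c → f′ y ≡ f y) → f′ c ≡ a + f c →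
                 sum (map f′ xs) ≡ a + sum (map f xs)
  sum-map-bump {f} {f′} a {xs = c ∷ xs} (c∉xs ∷ _) (here refl) off at = begin
    f′ c + sum (map f′ xs)
      ≡⟨ cong₂ _+_ at (sum-map-cong xs (λ y∈ → off _ (≢-sym (All.lookup c∉xs y∈)))) ⟩
    a + f c + sum (map f xs)
      ≡⟨ +-assoc a (f c) _ ⟩
    a + (f c + sum (map f xs)) ∎
  sum-map-bump {f} {f′} a {xs = y ∷ xs} (y∉xs ∷ u) (there c∈xs) off at = begin
    f′ y + sum (map f′ xs)
      ≡⟨ cong₂ _+_ (off y (All.lookup y∉xs c∈xs)) (sum-map-bump a u c∈xs off at) ⟩
    f y + (a + sum (map f xs))
      ≡⟨ x∙yz≈y∙xz (f y) a _ ⟩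
    a + (f y + sum (map f xs)) ∎

module _ {A : Set} {P : A → Set} (P? : Decidable P) where

  length-filter-≡1 : {c : A} {xs : List A} → Unique xs → c ∈ xs → P c →
                     (∀ {x} → x ∈ xs → P x → x ≡ c) → length (filter P? xs) ≡ 1
  length-filter-≡1 {xs = c ∷ xs} (c∉xs ∷ _) (here refl) Pc only-c =
    trans (cong length (filter-accept P? Pc)) (cong (suc ∘ length) (filter-none P? (All.tabulate ¬P)))
    where
    ¬P : ∀ {x} → x ∈ xs → ¬ P x
    ¬P x∈ Px = All.lookup c∉xs x∈ (sym (only-c (there x∈) Px))
  length-filter-≡1 {xs = y ∷ xs} (y∉xs ∷ u) (there c∈xs) Pc only-c =
    trans (cong length (filter-reject P? (λ Py → All.lookup y∉xs c∈xs (only-c (here refl) Py))))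
          (length-filter-≡1 u c∈xs Pc (only-c ∘ there))

  filter-filter-⊆ : {Q : A → Set} (Q? : Decidable Q) → P ⊆ Q →
                    ∀ xs → filter P? (filter Q? xs) ≡ filter P? xs
  filter-filter-⊆ Q? P⊆Q [] = refl
  filter-filter-⊆ Q? P⊆Q (x ∷ xs) with P? x
  ... | yes Px = begin
    filter P? (filter Q? (x ∷ xs)) ≡⟨ cong (filter P?) (filter-accept Q? (P⊆Q Px)) ⟩
    filter P? (x ∷ filter Q? xs)   ≡⟨ filter-accept P? Px ⟩
    x ∷ filter P? (filter Q? xs)   ≡⟨ cong (x ∷_) (filter-filter-⊆ Q? P⊆Q xs) ⟩
    x ∷ filter P? xs               ∎
  ... | no ¬Px with Q? x
  ...   | yes _ = trans (filter-reject P? ¬Px) (filter-filter-⊆ Q? P⊆Q xs)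
  ...   | no  _ = filter-filter-⊆ Q? P⊆Q xs

module _ {A B : Set} (_≟_ : DecidableEquality B) (h : A → B) where

  fibreSize : List A → B → ℕ
  fibreSize xs y = length (filter (λ x → h x ≟ y) xs)

  sum-map-fibres : (g : B → ℕ) {ys : List B} → Unique ys → ∀ xs → (∀ {x} → x ∈ xs → h x ∈ ys) →
                   sum (map (g ∘ h) xs) ≡ sum (map (λ y → g y * fibreSize xs y) ys)
  sum-map-fibres g {ys} _ [] _ = sym (sum-map-zero ys (λ {y} _ → *-zeroʳ (g y)))
  sum-map-fibres g {ys} u (x ∷ xs) into = sym (begin
    sum (map (λ y → g y * fibreSize (x ∷ xs) y) ys)
      ≡⟨ sum-map-bump (g (h x)) u (into (here refl)) off at ⟩
    g (h x) + sum (map (λ y → g y * fibreSize xs y) ys)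
      ≡⟨ cong (g (h x) +_) (sum-map-fibres g u xs (into ∘ there)) ⟨
    g (h x) + sum (map (g ∘ h) xs) ∎)
    where
    off : ∀ y → y ≢ h x → g y * fibreSize (x ∷ xs) y ≡ g y * fibreSize xs y
    off y y≢hx = cong (λ zs → g y * length zs) (filter-reject (λ z → h z ≟ y) (y≢hx ∘ sym))
    at : g (h x) * fibreSize (x ∷ xs) (h x) ≡ g (h x) + g (h x) * fibreSize xs (h x)
    at = trans (cong (λ zs → g (h x) * length zs) (filter-accept (λ z → h z ≟ h x) refl))
               (*-suc (g (h x)) _)

module _ {n : ℕ} .{{_ : NonZero n}} where

  +-cong-mod : ∀ {a a′ b b′} → a % n ≡ a′ % n → b % n ≡ b′ % n → (a + b) % n ≡ (a′ + b′) % n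
  +-cong-mod {a} {a′} {b} {b′} a≡a′ b≡b′ = begin
    (a + b) % n           ≡⟨ %-distribˡ-+ a b n ⟩
    (a % n + b % n) % n   ≡⟨ cong₂ (λ u v → (u + v) % n) a≡a′ b≡b′ ⟩
    (a′ % n + b′ % n) % n ≡⟨ %-distribˡ-+ a′ b′ n ⟨
    (a′ + b′) % n         ∎

  +-identityʳ-mod : ∀ a {b} → b % n ≡ 0 % n → (a + b) % n ≡ a % n
  +-identityʳ-mod a b≡0 = trans (+-cong-mod refl b≡0) (cong (_% n) (+-identityʳ a))

  *-identityʳ-mod : ∀ a {b} → b % n ≡ 1 % n → (a * b) % n ≡ a % n
  *-identityʳ-mod a {b} b≡1 = begin
    (a * b) % n             ≡⟨ %-distribˡ-* a b n ⟩
    (a % n * (b % n)) % n   ≡⟨ cong (λ v → (a % n * v) % n) b≡1 ⟩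
    (a % n * (1 % n)) % n   ≡⟨ %-distribˡ-* a 1 n ⟨
    (a * 1) % n             ≡⟨ cong (_% n) (*-identityʳ a) ⟩
    a % n                   ∎

  module _ {A : Set} where

    sum-cong-mod : {g h : A → ℕ} (xs : List A) → (∀ {x} → x ∈ xs → g x % n ≡ h x % n) →
                   sum (map g xs) % n ≡ sum (map h xs) % n
    sum-cong-mod []       _   = refl
    sum-cong-mod (x ∷ xs) g≡h = +-cong-mod (g≡h (here refl)) (sum-cong-mod xs (g≡h ∘ there))

    sum-zero-mod : {g : A → ℕ} (xs : List A) → (∀ {x} → x ∈ xs → g x % n ≡ 0 % n) →
                   sum (map g xs) % n ≡ 0 % n
    sum-zero-mod xs g≡0 = trans (sum-cong-mod xs g≡0) (cong (_% n) (sum-map-zero xs (λ _ → refl)))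

  module _ {A B : Set} (_≟_ : DecidableEquality B) (h : A → B) where

    sum-map-fibres-mod : (g : B → ℕ) {ys : List B} {xs : List A} → Unique ys →
                         (∀ {x} → x ∈ xs → h x ∈ ys) →
                         (∀ {y} → y ∈ ys → fibreSize _≟_ h xs y % n ≡ 1 % n) →
                         sum (map (g ∘ h) xs) % n ≡ sum (map g ys) % n
    sum-map-fibres-mod g {ys} {xs} u into fibres =
      trans (cong (_% n) (sum-map-fibres _≟_ h g u xs into))
            (sum-cong-mod ys (λ {y} y∈ → *-identityʳ-mod (g y) (fibres y∈)))

  module Orbits (X : FPSet n) where
    open FPSet X

    ζ^ : ℕ → Carrier → Carrier
    ζ^ k = iter k ζ·

    ζ^-+ : ∀ a b x → ζ^ (a + b) x ≡ ζ^ a (ζ^ b x)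
    ζ^-+ a b x = iter-+ a b ζ· x

    ζ^-*n : ∀ q x → ζ^ (q * n) x ≡ x
    ζ^-*n zero    x = refl
    ζ^-*n (suc q) x = trans (ζ^-+ n (q * n) x) (trans (ζⁿ _) (ζ^-*n q x))

    ζ^-% : ∀ k x → ζ^ (k % n) x ≡ ζ^ k x
    ζ^-% k x = sym (begin
      ζ^ k x                         ≡⟨ cong (λ m → ζ^ m x) (m≡m%n+[m/n]*n k n) ⟩
      ζ^ (k % n + (k / n) * n) x     ≡⟨ ζ^-+ (k % n) _ x ⟩
      ζ^ (k % n) (ζ^ ((k / n) * n) x) ≡⟨ cong (ζ^ (k % n)) (ζ^-*n (k / n) x) ⟩
      ζ^ (k % n) x                   ∎)

    ζ^-cong-mod : ∀ {a b} x → a % n ≡ b % n → ζ^ a x ≡ ζ^ b x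
    ζ^-cong-mod {a} {b} x a≡b = trans (sym (ζ^-% a x)) (trans (cong (λ m → ζ^ m x) a≡b) (ζ^-% b x))

    ζ^-pt : ∀ k → ζ^ k pt ≡ pt
    ζ^-pt zero    = refl
    ζ^-pt (suc k) = trans (cong ζ· (ζ^-pt k)) fixPt

    ζ^-inverse : ∀ k x → ζ^ (n ∸ k % n) (ζ^ k x) ≡ x
    ζ^-inverse k x = begin
      ζ^ (n ∸ k % n) (ζ^ k x)         ≡⟨ cong (ζ^ (n ∸ k % n)) (ζ^-% k x) ⟨
      ζ^ (n ∸ k % n) (ζ^ (k % n) x)   ≡⟨ ζ^-+ (n ∸ k % n) (k % n) x ⟨
      ζ^ (n ∸ k % n + k % n) x        ≡⟨ cong (λ m → ζ^ m x) (m∸n+n≡m (<⇒≤ (m%n<n k n))) ⟩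
      ζ^ n x                          ≡⟨ ζⁿ x ⟩
      x                               ∎

    _∼_ : Carrier → Carrier → Set
    x ∼ y = ∃ λ k → y ≡ ζ^ k x

    ∼-refl : ∀ {x} → x ∼ x
    ∼-refl = 0 , refl

    ∼-sym : ∀ {x y} → x ∼ y → y ∼ x
    ∼-sym {x} (k , refl) = n ∸ k % n , sym (ζ^-inverse k x)

    ∼-trans : ∀ {x y z} → x ∼ y → y ∼ z → x ∼ z
    ∼-trans {x} (j , refl) (k , refl) = k + j , sym (ζ^-+ k j x)

    ∼-ζ : ∀ x → x ∼ ζ· x
    ∼-ζ x = 1 , refl

    ∼-≢pt : ∀ {x y} → x ≢ pt → x ∼ y → y ≢ pt
    ∼-≢pt x≢pt x∼y refl with ∼-sym x∼y
    ... | k , x≡ζ^kpt = x≢pt (trans x≡ζ^kpt (ζ^-pt k))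

    ∼-reduce : ∀ {x y} → x ∼ y → ∃ λ (i : Fin n) → y ≡ ζ^ (toℕ i) x
    ∼-reduce {x} (k , refl) = fromℕ< (m%n<n k n) ,
      sym (trans (cong (λ m → ζ^ m x) (toℕ-fromℕ< (m%n<n k n))) (ζ^-% k x))

    _∼?_ : ∀ x y → Dec (x ∼ y)
    x ∼? y = map′ (λ (i , e) → toℕ i , e) ∼-reduce (any? λ (i : Fin n) → y ≟ ζ^ (toℕ i) x)

    ζ^-cancel≤ : ∀ {x} a b → x ≢ pt → a ≤ b → ζ^ a x ≡ ζ^ b x → a % n ≡ b % n
    ζ^-cancel≤ {x} a b x≢pt a≤b e = begin
      a % n             ≡⟨ %-remove-+ˡ a (free (ζ^ a x) (∼-≢pt x≢pt (a , refl)) (b ∸ a) loop) ⟨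
      (b ∸ a + a) % n   ≡⟨ cong (_% n) (m∸n+n≡m a≤b) ⟩
      b % n             ∎
      where
      loop : ζ^ (b ∸ a) (ζ^ a x) ≡ ζ^ a x
      loop = trans (sym (ζ^-+ (b ∸ a) a x)) (trans (cong (λ m → ζ^ m x) (m∸n+n≡m a≤b)) (sym e))

    ζ^-cancel : ∀ {x} a b → x ≢ pt → ζ^ a x ≡ ζ^ b x → a % n ≡ b % n
    ζ^-cancel a b x≢pt e with ≤-total a b
    ... | inj₁ a≤b = ζ^-cancel≤ a b x≢pt a≤b e
    ... | inj₂ b≤a = sym (ζ^-cancel≤ b a x≢pt b≤a (sym e))

    findExponent : {P : Carrier → Set} → Decidable P → Carrier → ℕ
    findExponent P? x with any? (λ (i : Fin n) → P? (ζ^ (toℕ i) x))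
    ... | yes (i , _) = toℕ i
    ... | no _        = 0

    findExponent-spec : {P : Carrier → Set} (P? : Decidable P) {x : Carrier} →
                        (∃ λ k → P (ζ^ k x)) → P (ζ^ (findExponent P? x) x)
    findExponent-spec {P} P? {x} (k , Pk) with any? (λ (i : Fin n) → P? (ζ^ (toℕ i) x))
    ... | yes (i , Pi) = Pi
    ... | no ¬Pi with ∼-reduce (k , refl)
    ...   | i , e = contradiction (i , subst P e Pk) ¬Pi

    offset : Carrier → Carrier → ℕ
    offset x y = findExponent (_≟ y) x

    offset-spec : ∀ {x y} → x ∼ y → y ≡ ζ^ (offset x y) x
    offset-spec {x} {y} (k , e) = sym (findExponent-spec (_≟ y) (k , sym e))

    offset-unique : ∀ {x y} k → x ≢ pt → y ≡ ζ^ k x → offset x y % n ≡ k % n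
    offset-unique k x≢pt e = ζ^-cancel _ k x≢pt (trans (sym (offset-spec (k , e))) e)

    open Sel

    elements-unique : Unique elements
    elements-unique = map⁺ (λ {i} {j} e → trans (sym (Inverse.strictlyInverseʳ enum i))
                              (trans (cong (Inverse.from enum) e) (Inverse.strictlyInverseʳ enum j)))
                           (allFin⁺ size)

    ∈-elements : ∀ x → x ∈ elements
    ∈-elements x = subst (_∈ elements) (Inverse.strictlyInverseˡ enum x)
                         (∈-map⁺ (Inverse.to enum) (∈-allFin (Inverse.from enum x)))

    module _ (r : Sel X) where

      sel-ζ^ : ∀ {x} → x ≢ pt → ∀ k → sel r (ζ^ k x) ≡ sel r x
      sel-ζ^ x≢pt zero    = refl
      sel-ζ^ x≢pt (suc k) = trans (orbConst r _ (∼-≢pt x≢pt (k , refl))) (sel-ζ^ x≢pt k)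

      sel-cong : ∀ {x y} → x ≢ pt → x ∼ y → sel r y ≡ sel r x
      sel-cong x≢pt (k , refl) = sel-ζ^ x≢pt k

      sel-≢pt : ∀ {x} → x ≢ pt → sel r x ≢ pt
      sel-≢pt x≢pt = ∼-≢pt x≢pt (inOrbit r _ x≢pt)

      sel-idem : ∀ {x} → x ≢ pt → sel r (sel r x) ≡ sel r x
      sel-idem x≢pt = sel-cong x≢pt (inOrbit r _ x≢pt)

      IsRep : Carrier → Set
      IsRep x = x ≢ pt × sel r x ≡ x

      isRep? : Decidable IsRep
      isRep? x = ¬? (x ≟ pt) ×-dec (sel r x ≟ x)

      ∈-reps⁻ : ∀ {x} → x ∈ reps r → IsRep x
      ∈-reps⁻ x∈ = proj₂ (∈-filter⁻ isRep? {xs = elements} x∈)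

      reps-≢pt : ∀ {x} → x ∈ reps r → x ≢ pt
      reps-≢pt = proj₁ ∘ ∈-reps⁻

      ∈-reps⁺ : ∀ {x} → IsRep x → x ∈ reps r
      ∈-reps⁺ {x} = ∈-filter⁺ isRep? (∈-elements x)

      reps-unique : Unique (reps r)
      reps-unique = filter⁺ isRep? elements-unique

      sel∈reps : ∀ {x} → x ≢ pt → sel r x ∈ reps r
      sel∈reps x≢pt = ∈-reps⁺ (sel-≢pt x≢pt , sel-idem x≢pt)

    sum-reps-mod : (r r′ : Sel X) (g : Carrier → ℕ) → (∀ {x y} → x ≢ pt → x ∼ y → g y ≡ g x) →
                   sum (map g (reps r)) % n ≡ sum (map g (reps r′)) % n
    sum-reps-mod r r′ g g-inv = begin
      sum (map g (reps r)) % n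
        ≡⟨ cong (_% n) (sum-map-cong (reps r) (sym ∘ g-sel)) ⟩
      sum (map (g ∘ sel r′) (reps r)) % n
        ≡⟨ sum-map-fibres-mod _≟_ (sel r′) g (reps-unique r′) (sel∈reps r′ ∘ reps-≢pt r) fibres ⟩
      sum (map g (reps r′)) % n ∎
      where
      g-sel : ∀ {x} → x ∈ reps r → g (sel r′ x) ≡ g x
      g-sel x∈ = g-inv (reps-≢pt r x∈) (inOrbit r′ _ (reps-≢pt r x∈))
      fibres : ∀ {y} → y ∈ reps r′ → fibreSize _≟_ (sel r′) (reps r) y % n ≡ 1 % n
      fibres {y} y∈ =
        cong (_% n) (length-filter-≡1 (λ x → sel r′ x ≟ y) (reps-unique r) (sel∈reps r y≢pt) hit only)
        where
        y≢pt = reps-≢pt r′ y∈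
        hit : sel r′ (sel r y) ≡ y
        hit = trans (sel-cong r′ y≢pt (inOrbit r y y≢pt)) (proj₂ (∈-reps⁻ r′ y∈))
        only : ∀ {x} → x ∈ reps r → sel r′ x ≡ y → x ≡ sel r y
        only {x} x∈ refl = trans (sym (proj₂ (∈-reps⁻ r x∈)))
                                 (sym (sel-cong r (reps-≢pt r x∈) (inOrbit r′ x (reps-≢pt r x∈))))

    sel-∼-sel : (r r′ : Sel X) → ∀ {x} → x ≢ pt → sel r x ∼ sel r′ x
    sel-∼-sel r r′ x≢pt = ∼-trans (∼-sym (inOrbit r _ x≢pt)) (inOrbit r′ _ x≢pt)

    δ : Sel X → Sel X → Carrier → ℕ
    δ r r′ x = offset (sel r x) (sel r′ x)

    δ-spec : (r r′ : Sel X) → ∀ {x} → x ≢ pt → sel r′ x ≡ ζ^ (δ r r′ x) (sel r x)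
    δ-spec r r′ x≢pt = offset-spec (sel-∼-sel r r′ x≢pt)

    δ-unique : (r r′ : Sel X) → ∀ {x} k → x ≢ pt → sel r′ x ≡ ζ^ k (sel r x) →
               δ r r′ x % n ≡ k % n
    δ-unique r r′ k x≢pt = offset-unique k (sel-≢pt r x≢pt)

    δ-cong : (r r′ : Sel X) → ∀ {x y} → x ≢ pt → x ∼ y → δ r r′ y ≡ δ r r′ x
    δ-cong r r′ x≢pt x∼y = cong₂ offset (sel-cong r x≢pt x∼y) (sel-cong r′ x≢pt x∼y)

    δ-cocycle : (r r′ r″ : Sel X) → ∀ {x} → x ≢ pt →
                (δ r r′ x + δ r′ r″ x) % n ≡ δ r r″ x % n
    δ-cocycle r r′ r″ {x} x≢pt = sym (δ-unique r r″ (a + b) x≢pt (begin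
      sel r″ x                     ≡⟨ δ-spec r′ r″ x≢pt ⟩
      ζ^ b (sel r′ x)              ≡⟨ cong (ζ^ b) (δ-spec r r′ x≢pt) ⟩
      ζ^ b (ζ^ a (sel r x))        ≡⟨ ζ^-+ b a _ ⟨
      ζ^ (b + a) (sel r x)         ≡⟨ cong (λ m → ζ^ m (sel r x)) (+-comm b a) ⟩
      ζ^ (a + b) (sel r x)         ∎))
      where
      a = δ r r′ x
      b = δ r′ r″ x

    δ-self : (r : Sel X) → ∀ {x} → x ≢ pt → δ r r x % n ≡ 0 % n
    δ-self r x≢pt = δ-unique r r 0 x≢pt refl

    Δ : Sel X → Sel X → ℕ
    Δ r r′ = sum (map (δ r r′) (reps r))

    Δ-cocycle : (r r′ r″ : Sel X) → (Δ r r′ + Δ r′ r″) % n ≡ Δ r r″ % n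
    Δ-cocycle r r′ r″ = begin
      (Δ r r′ + Δ r′ r″) % n
        ≡⟨ +-cong-mod refl (sum-reps-mod r′ r (δ r′ r″) (δ-cong r′ r″)) ⟩
      (Δ r r′ + sum (map (δ r′ r″) (reps r))) % n
        ≡⟨ cong (_% n) (sum-map-+ (δ r r′) (δ r′ r″) (reps r)) ⟨
      sum (map (λ x → δ r r′ x + δ r′ r″ x) (reps r)) % n
        ≡⟨ sum-cong-mod (reps r) (δ-cocycle r r′ r″ ∘ reps-≢pt r) ⟩
      Δ r r″ % n ∎

    Δ-self : (r : Sel X) → Δ r r % n ≡ 0 % n
    Δ-self r = sum-zero-mod (reps r) (δ-self r ∘ reps-≢pt r)

    Δ-cancel : (r r′ : Sel X) → ∀ k → (k + Δ r r′ + Δ r′ r) % n ≡ k % n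
    Δ-cancel r r′ k = begin
      (k + Δ r r′ + Δ r′ r) % n     ≡⟨ cong (_% n) (+-assoc k _ _) ⟩
      (k + (Δ r r′ + Δ r′ r)) % n   ≡⟨ +-cong-mod {a = k} refl (Δ-cocycle r r′ r) ⟩
      (k + Δ r r) % n               ≡⟨ +-identityʳ-mod k (Δ-self r) ⟩
      k % n                         ∎

    _≈_ : Det X → Det X → Set
    _≈_ = _≈Det_ {X = X}

    ≈Det⇒Δ : ∀ k k′ (r r′ : Sel X) → just (k , r) ≈ just (k′ , r′) →
             (k + Δ r r′) % n ≡ k′ % n
    ≈Det⇒Δ k k′ r r′ (d , r′≡ , k≡) = trans (+-cong-mod {a = k} refl (sum-cong-mod (reps r) δ≡d)) k≡
      where
      δ≡d : ∀ {x} → x ∈ reps r → δ r r′ x % n ≡ d x % n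
      δ≡d x∈ = δ-unique r r′ _ (reps-≢pt r x∈) (r′≡ _ (reps-≢pt r x∈))

    Δ⇒≈Det : ∀ k k′ (r r′ : Sel X) → (k + Δ r r′) % n ≡ k′ % n →
             just (k , r) ≈ just (k′ , r′)
    Δ⇒≈Det k k′ r r′ k≡ = δ r r′ , (λ _ → δ-spec r r′) , k≡

    ≈Det-sel : ∀ k (r r′ : Sel X) → (∀ x → x ≢ pt → sel r′ x ≡ sel r x) →
               just (k , r) ≈ just (k , r′)
    ≈Det-sel k r r′ r′≡r = (λ _ → 0) , r′≡r ,
      cong (_% n) (trans (cong (k +_) (sum-map-zero (reps r) (λ _ → refl))) (+-identityʳ k))

    firstInOrbit : Carrier → Carrier
    firstInOrbit x = fromMaybe x (head (filter (x ∼?_) elements))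

    firstInOrbit-∼ : ∀ x → x ∼ firstInOrbit x
    firstInOrbit-∼ x = fromMaybe-head-∼ (filter (x ∼?_) elements) (all-filter (x ∼?_) elements)
      where
      fromMaybe-head-∼ : ∀ ys → All (x ∼_) ys → x ∼ fromMaybe x (head ys)
      fromMaybe-head-∼ []       _       = ∼-refl
      fromMaybe-head-∼ (y ∷ ys) (x∼y ∷ _) = x∼y

    firstInOrbit-ζ : ∀ x → firstInOrbit (ζ· x) ≡ firstInOrbit x
    firstInOrbit-ζ x = begin
      fromMaybe (ζ· x) (head (filter (ζ· x ∼?_) elements))
        ≡⟨ cong (fromMaybe (ζ· x) ∘ head) same-orbit ⟩
      fromMaybe (ζ· x) (head (filter (x ∼?_) elements))
        ≡⟨ fromMaybe-head (∈-filter⁺ (x ∼?_) (∈-elements x) ∼-refl) ⟩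
      fromMaybe x (head (filter (x ∼?_) elements)) ∎
      where
      same-orbit : filter (ζ· x ∼?_) elements ≡ filter (x ∼?_) elements
      same-orbit = filter-≐ (ζ· x ∼?_) (x ∼?_) (∼-trans (∼-ζ x) , ∼-trans (∼-sym (∼-ζ x))) elements
      fromMaybe-head : ∀ {y ys} → y ∈ ys → fromMaybe (ζ· x) (head ys) ≡ fromMaybe x (head ys)
      fromMaybe-head (here _)  = refl
      fromMaybe-head (there _) = refl

    firstInOrbitSel : Sel X
    firstInOrbitSel = record
      { sel      = firstInOrbit
      ; inOrbit  = λ x _ → firstInOrbit-∼ x
      ; orbConst = λ x _ → firstInOrbit-ζ x
      }

  module Lift {X Y : FPSet n} (f : Hom X Y)
              (reflects-pt : ∀ x → Hom.fun f x ≡ FPSet.pt Y → x ≡ FPSet.pt X) where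
    module X = Orbits X
    module Y = Orbits Y
    open FPSet using (Carrier; pt)
    open FPSet Y using () renaming (_≟_ to _≟Y_)
    open Sel
    open Hom f renaming (fun to F)

    F-ζ^ : ∀ k x → F (X.ζ^ k x) ≡ Y.ζ^ k (F x)
    F-ζ^ zero    x = refl
    F-ζ^ (suc k) x = trans (equivar _) (cong (FPSet.ζ· Y) (F-ζ^ k x))

    F-≢pt : ∀ {x} → x ≢ pt X → F x ≢ pt Y
    F-≢pt x≢pt = x≢pt ∘ reflects-pt _

    F-injective-on-orbit : ∀ {x y y′} → x ≢ pt X → x X.∼ y → x X.∼ y′ →
                           F y ≡ F y′ → y ≡ y′
    F-injective-on-orbit {x} x≢pt (a , refl) (b , refl) Fy≡Fy′ =
      X.ζ^-cong-mod x (Y.ζ^-cancel a b (F-≢pt x≢pt) (trans (sym (F-ζ^ a x)) (trans Fy≡Fy′ (F-ζ^ b x))))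

    liftExponent : Sel Y → Carrier X → ℕ
    liftExponent s x = X.findExponent (λ z → F z ≟Y sel s (F x)) x

    lift : Sel Y → Carrier X → Carrier X
    lift s x = X.ζ^ (liftExponent s x) x

    module _ (s : Sel Y) where

      lift-∼ : ∀ x → x X.∼ lift s x
      lift-∼ x = liftExponent s x , refl

      lift-over : ∀ {x} → x ≢ pt X → F (lift s x) ≡ sel s (F x)
      lift-over {x} x≢pt with inOrbit s (F x) (F-≢pt x≢pt)
      ... | k , e = X.findExponent-spec (λ z → F z ≟Y sel s (F x)) (k , trans (F-ζ^ k x) (sym e))

      lift-unique : ∀ {x y} → x ≢ pt X → x X.∼ y → F y ≡ sel s (F x) → y ≡ lift s x
      lift-unique x≢pt x∼y Fy≡ =
        F-injective-on-orbit x≢pt x∼y (lift-∼ _) (trans Fy≡ (sym (lift-over x≢pt)))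

      liftSel : Sel X
      liftSel = record
        { sel      = lift s
        ; inOrbit  = λ x _ → lift-∼ x
        ; orbConst = λ x x≢pt → sym (lift-ζ x≢pt)
        }
        where
        lift-ζ : ∀ {x} → x ≢ pt X → lift s x ≡ lift s (FPSet.ζ· X x)
        lift-ζ {x} x≢pt = lift-unique (X.∼-≢pt x≢pt (X.∼-ζ x)) (X.∼-trans (X.∼-sym (X.∼-ζ x)) (lift-∼ x))
                            (trans (lift-over x≢pt) (sym (Y.sel-cong s (F-≢pt x≢pt) (1 , equivar x))))

    δ-liftSel : (s s′ : Sel Y) → ∀ {x} → x ≢ pt X →
                X.δ (liftSel s) (liftSel s′) x % n ≡ Y.δ s s′ (F x) % n
    δ-liftSel s s′ {x} x≢pt = sym (Y.δ-unique s s′ _ (F-≢pt x≢pt) (begin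
      sel s′ (F x)                  ≡⟨ lift-over s′ x≢pt ⟨
      F (lift s′ x)                 ≡⟨ cong F (X.δ-spec (liftSel s) (liftSel s′) x≢pt) ⟩
      F (X.ζ^ d (lift s x))         ≡⟨ F-ζ^ d _ ⟩
      Y.ζ^ d (F (lift s x))         ≡⟨ cong (Y.ζ^ d) (lift-over s x≢pt) ⟩
      Y.ζ^ d (sel s (F x))          ∎))
      where d = X.δ (liftSel s) (liftSel s′) x

    module _ (fibres≡1 : ∀ y → y ≢ pt Y → fiberSize f y % n ≡ 1 % n) where

      sum-reps-liftSel-mod : (s : Sel Y) (g : Carrier Y → ℕ) →
                             sum (map (g ∘ F) (reps (liftSel s))) % n ≡ sum (map g (reps s)) % n
      sum-reps-liftSel-mod s g = sum-map-fibres-mod _≟Y_ F g (Y.reps-unique s) into fibres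
        where
        into : ∀ {x} → x ∈ reps (liftSel s) → F x ∈ reps s
        into x∈ with X.∈-reps⁻ (liftSel s) x∈
        ... | x≢pt , lift≡x =
          Y.∈-reps⁺ s (F-≢pt x≢pt , sym (trans (cong F (sym lift≡x)) (lift-over s x≢pt)))
        fibres : ∀ {y} → y ∈ reps s → fibreSize _≟Y_ F (reps (liftSel s)) y % n ≡ 1 % n
        fibres {y} y∈ with Y.∈-reps⁻ s y∈
        ... | y≢pt , sy≡y = trans (cong (λ xs → length xs % n)
                                   (filter-filter-⊆ (λ x → F x ≟Y y) (X.isRep? (liftSel s)) over⇒rep (FPSet.elements X)))
                                  (fibres≡1 y y≢pt)
          where
          over⇒rep : ∀ {x} → F x ≡ y → X.IsRep (liftSel s) x
          over⇒rep {x} refl = x≢pt , sym (lift-unique s x≢pt X.∼-refl (sym sy≡y))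
            where x≢pt = λ x≡pt → y≢pt (trans (cong F x≡pt) pointed)

      Δ-liftSel : (s s′ : Sel Y) → X.Δ (liftSel s) (liftSel s′) % n ≡ Y.Δ s s′ % n
      Δ-liftSel s s′ = trans (sum-cong-mod (reps (liftSel s)) (δ-liftSel s s′ ∘ X.reps-≢pt (liftSel s)))
                             (sum-reps-liftSel-mod s (Y.δ s s′))

      s₀ : Sel Y
      s₀ = Y.firstInOrbitSel

      r₀ : Sel X
      r₀ = liftSel s₀

      to : Det Y → Det X
      to nothing        = nothing
      to (just (k , s)) = just (k , liftSel s)

      from : Det X → Det Y
      from nothing        = nothing
      from (just (k , r)) = just (k + X.Δ r r₀ , s₀)

      to-cong : ∀ {a b} → a Y.≈ b → to a X.≈ to b
      to-cong {nothing}      {nothing}        _   = tt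
      to-cong {just (k , s)} {just (k′ , s′)} a≈b =
        X.Δ⇒≈Det k k′ (liftSel s) (liftSel s′)
          (trans (+-cong-mod {a = k} refl (Δ-liftSel s s′)) (Y.≈Det⇒Δ k k′ s s′ a≈b))

      from-cong : ∀ {a b} → a X.≈ b → from a Y.≈ from b
      from-cong {nothing}      {nothing}        _   = tt
      from-cong {just (k , r)} {just (k′ , r′)} a≈b =
        Y.Δ⇒≈Det (k + X.Δ r r₀) (k′ + X.Δ r′ r₀) s₀ s₀ (begin
        (k + X.Δ r r₀ + Y.Δ s₀ s₀) % n      ≡⟨ +-identityʳ-mod _ (Y.Δ-self s₀) ⟩
        (k + X.Δ r r₀) % n                  ≡⟨ +-cong-mod {a = k} refl (X.Δ-cocycle r r′ r₀) ⟨
        (k + (X.Δ r r′ + X.Δ r′ r₀)) % n    ≡⟨ cong (_% n) (+-assoc k _ _) ⟨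
        (k + X.Δ r r′ + X.Δ r′ r₀) % n      ≡⟨ +-cong-mod (X.≈Det⇒Δ k k′ r r′ a≈b) refl ⟩
        (k′ + X.Δ r′ r₀) % n                ∎)

      from-to : ∀ a → from (to a) Y.≈ a
      from-to nothing        = tt
      from-to (just (k , s)) = Y.Δ⇒≈Det (k + X.Δ (liftSel s) r₀) k s₀ s (begin
        (k + X.Δ (liftSel s) r₀ + Y.Δ s₀ s) % n
          ≡⟨ +-cong-mod (+-cong-mod {a = k} refl (Δ-liftSel s s₀)) refl ⟩
        (k + Y.Δ s s₀ + Y.Δ s₀ s) % n
          ≡⟨ Y.Δ-cancel s s₀ k ⟩
        k % n ∎)

      to-from : ∀ b → to (from b) X.≈ b
      to-from nothing        = tt
      to-from (just (k , r)) = X.Δ⇒≈Det (k + X.Δ r r₀) k r₀ r (X.Δ-cancel r r₀ k)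

      detIso : DetIso Y X
      detIso = record
        { to        = to
        ; from      = from
        ; to-cong   = to-cong
        ; from-cong = from-cong
        ; from-to   = from-to
        ; to-from   = to-from
        ; to-pt     = tt
        ; to-equiv  = λ { nothing        → tt
                        ; (just (k , s)) → X.≈Det-sel (suc k) (liftSel s) (liftSel s) (λ _ _ → refl) }
        }

      detIso-canonical : Canonical f detIso
      detIso-canonical s r r-over =
        X.≈Det-sel 0 (liftSel s) r λ x x≢pt → lift-unique s x≢pt (inOrbit r x x≢pt) (r-over x x≢pt)

mainTheorem12 : (n : ℕ) .{{_ : NonZero n}} (X Y : FPSet n) (f : Hom X Y) →
    (∀ x → Hom.fun f x ≡ FPSet.pt Y → x ≡ FPSet.pt X) →
    (∀ y → y ≢ FPSet.pt Y → fiberSize f y % n ≡ 1 % n) →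
    Σ (DetIso Y X) (λ φ → Canonical f φ)
mainTheorem12 n X Y f reflects-pt fibres≡1 = detIso fibres≡1 , detIso-canonical fibres≡1
  where open Lift f reflects-pt
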